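{- Let $\sigma,\nu\in\mathfrak S_n$ with $\nu>\sigma$ in the Bruhat order, and let $1\le k<n$. Then the intersection of the coset $\sigma(\mathfrak S_k\times\mathfrak S_{n-k})=\{\mu\in\mathfrak S_n:\{\mu_1,\dots,\mu_k\}=\{\sigma_1,\dots,\sigma_k\}\}$ with the Bruhat interval $[\sigma,\nu]$ is an interval of the Bruhat order (it has a unique minimal and a unique maximal element).
   Context: $\mathfrak S_n$: permutations of $\{1,\dots,n\}$ written as words $\mu=\mu_1\cdots\mu_n$. Bruhat order: $\sigma\le\mu$ iff a reduced decomposition of $\sigma$ (as a product of simple transpositions $s_i=(i,i+1)$) is a subword of a reduced decomposition of $\mu$; equivalently, for all $1\le r,k<n$, $\#\{i\le k:\sigma_i\le r\}\ge\#\{i\le k:\mu_i\le r\}$. -}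

module Defs where

open import Data.Nat using (ℕ; _<_; _≤_; _<?_)
open import Data.Fin using (Fin; toℕ)
open import Data.List using (List; length; filter)
open import Data.List.Base using (allFin)
open import Data.Product using (_×_; ∃-syntax)
open import Relation.Nullary using (¬_)
open import Relation.Nullary.Decidable using (_×-dec_)
open import Relation.Binary.PropositionalEquality using (_≡_)
open import Data.Fin.Permutation public using (Permutation′; _⟨$⟩ʳ_)

-- A permutation μ ∈ 𝔖ₙ is an element of Permutation′ n; the one-line word is
-- μ₁ ⋯ μₙ with μ_{i+1} = μ ⟨$⟩ʳ i (0-based indices and values in Fin n).

-- rank σ k r = #{ i ≤ k : σ_i ≤ r } in 1-based terms,
-- i.e. #{ i : Fin n | toℕ i < k and toℕ (σ i) < r } in 0-based terms.
rank : ∀ {n} → Permutation′ n → ℕ → ℕ → ℕ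
rank {n} σ k r =
  length (filter (λ i → (toℕ i <? k) ×-dec (toℕ (σ ⟨$⟩ʳ i) <? r)) (allFin n))

-- Bruhat order (rank criterion): σ ≤ μ iff for all 1 ≤ r,k < n,
-- #{i ≤ k : σ_i ≤ r} ≥ #{i ≤ k : μ_i ≤ r}.
_≤B_ : ∀ {n} → Permutation′ n → Permutation′ n → Set
_≤B_ {n} σ μ = ∀ r k → 1 ≤ r → r < n → 1 ≤ k → k < n → rank μ k r ≤ rank σ k r

_≈P_ : ∀ {n} → Permutation′ n → Permutation′ n → Set
σ ≈P μ = ∀ i → σ ⟨$⟩ʳ i ≡ μ ⟨$⟩ʳ i

_<B_ : ∀ {n} → Permutation′ n → Permutation′ n → Set
σ <B μ = σ ≤B μ × ¬ (σ ≈P μ)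

InCoset : ∀ {n} → ℕ → Permutation′ n → Permutation′ n → Set
InCoset {n} k σ μ = ∀ (j : Fin n) →
  ((∃[ i ] (toℕ i < k × μ ⟨$⟩ʳ i ≡ j)) → (∃[ i ] (toℕ i < k × σ ⟨$⟩ʳ i ≡ j)))
  × ((∃[ i ] (toℕ i < k × σ ⟨$⟩ʳ i ≡ j)) → (∃[ i ] (toℕ i < k × μ ⟨$⟩ʳ i ≡ j)))

InCosetInterval : ∀ {n} → ℕ → Permutation′ n → Permutation′ n → Permutation′ n → Set
InCosetInterval k σ ν μ = InCoset k σ μ × (σ ≤B μ × μ ≤B ν)

module Submission where

-- Encode a permutation μ by its rank function rk μ j r = #{i < j : μ_i < r} on the grid
-- 0 ≤ j, r ≤ n. Bruhat order is the reverse pointwise order of rank functions, and μ lies in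
-- the coset σ(𝔖_k × 𝔖_{n-k}) iff row k of rk μ is A := rk σ k; so σ is the least element of
-- the intersection. Rank functions satisfy the quadrangle inequality
--   rk(j₁,r₂) + rk(j₂,r₁) ≤ rk(j₁,r₁) + rk(j₂,r₂)   for j₁ ≤ j₂ and r₁ ≤ r₂,
-- and combining it with row k shows that every μ of the intersection has rk μ ≥ R, where
--   R j r = A r + max (rk ν j y − A y),   over y ≥ r if j ≤ k and over y ≤ r if j ≥ k.
-- Row j+1 of rk ν exceeds row j by one exactly to the right of ν_j, and such a bump survives
-- these maxima, so R has the increments of a rank function: R = rk b for a permutation b,
-- which is the greatest element of the intersection.

open import Defs
open import Data.Nat
open import Data.Nat.Properties
open import Data.Bool using (Bool; true; false; _∧_)
open import Data.Fin as F using (Fin; toℕ; fromℕ<)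
open import Data.Fin.Permutation using (inverseˡ; inverseʳ; _⟨$⟩ˡ_; permutation)
import Data.Fin.Properties as FP
open import Data.List using (length; filter; tabulate)
open import Data.Product using (_×_; _,_; proj₁; proj₂; ∃-syntax)
open import Data.Sum as Sum using (_⊎_; inj₁; inj₂; [_,_]′)
open import Data.Empty using (⊥-elim)
open import Relation.Nullary using (¬_; Dec; yes; no; does)
open import Relation.Nullary.Decidable using (dec-true; dec-false)
open import Relation.Binary.PropositionalEquality hiding ([_])
open import Function using (_∘_; id)
open import Function.Bundles using (_⇔_; mk⇔; Equivalence)
open import Relation.Binary using (tri<; tri≈; tri>)
open import Data.Nat.Tactic.RingSolver using (solve-∀)
open import Algebra.Properties.CommutativeMonoid.Sum +-0-commutativeMonoid
  using (sum; sum-cong-≗; ∑-distrib-+; sum-replicate-zero)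

𝟙 : Bool → ℕ
𝟙 true = 1
𝟙 false = 0

𝟙-∧ : ∀ x y → 𝟙 (x ∧ y) ≡ 𝟙 x * 𝟙 y
𝟙-∧ true true = refl
𝟙-∧ true false = refl
𝟙-∧ false y = refl

[_<_] : ℕ → ℕ → ℕ
[ a < b ] = 𝟙 (does (a <? b))

δ : ℕ → ℕ → ℕ
δ a b = 𝟙 (does (a ≟ b))

[<]-yes : ∀ {a b} → a < b → [ a < b ] ≡ 1
[<]-yes {a} {b} p = cong 𝟙 (dec-true (a <? b) p)

[<]-no : ∀ {a b} → ¬ a < b → [ a < b ] ≡ 0
[<]-no {a} {b} p = cong 𝟙 (dec-false (a <? b) p)

δ-yes : ∀ {a b} → a ≡ b → δ a b ≡ 1
δ-yes {a} {b} p = cong 𝟙 (dec-true (a ≟ b) p)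

δ-no : ∀ {a b} → a ≢ b → δ a b ≡ 0
δ-no {a} {b} p = cong 𝟙 (dec-false (a ≟ b) p)

1≤δ⇒≡ : ∀ {a b} → 1 ≤ δ a b → a ≡ b
1≤δ⇒≡ {a} {b} p with a ≟ b
... | yes e = e
... | no a≢b = ⊥-elim (1+n≰n (subst (1 ≤_) (δ-no a≢b) p))

[<]-cases : ∀ a b → (a < b × [ a < b ] ≡ 1) ⊎ (¬ a < b × [ a < b ] ≡ 0)
[<]-cases a b with a <? b
... | yes p = inj₁ (p , [<]-yes p)
... | no p = inj₂ (p , [<]-no p)

[<]≡1⇒< : ∀ {a b} → [ a < b ] ≡ 1 → a < b
[<]≡1⇒< {a} {b} e with [<]-cases a b
... | inj₁ (p , _) = p
... | inj₂ (_ , e′) = ⊥-elim (0≢1+n (trans (sym e′) e))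

[<]-mono : ∀ a {b c} → b ≤ c → [ a < b ] ≤ [ a < c ]
[<]-mono a {b} {c} b≤c with [<]-cases a b
... | inj₁ (a<b , e) = ≤-reflexive (trans e (sym ([<]-yes (<-≤-trans a<b b≤c))))
... | inj₂ (_ , e) = subst (_≤ _) (sym e) z≤n

[<]-cong : ∀ {a b k} → (a < k → b < k) → (b < k → a < k) → [ a < k ] ≡ [ b < k ]
[<]-cong {a} {b} {k} a⇒b b⇒a with [<]-cases a k | [<]-cases b k
... | inj₁ (_ , e) | inj₁ (_ , e′) = trans e (sym e′)
... | inj₂ (_ , e) | inj₂ (_ , e′) = trans e (sym e′)
... | inj₁ (p , _) | inj₂ (q , _) = ⊥-elim (q (a⇒b p))
... | inj₂ (p , _) | inj₁ (q , _) = ⊥-elim (p (b⇒a q))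

[<]-suc : ∀ a b → [ a < suc b ] ≡ [ a < b ] + δ a b
[<]-suc a b with <-cmp a b
... | tri< a<b _ _ =
  trans ([<]-yes (m<n⇒m<1+n a<b)) (cong₂ _+_ (sym ([<]-yes a<b)) (sym (δ-no (<⇒≢ a<b))))
... | tri≈ _ refl _ =
  trans ([<]-yes (n<1+n a)) (cong₂ _+_ (sym ([<]-no (n≮n a))) (sym (δ-yes {a} refl)))
... | tri> _ a≢b b<a =
  trans ([<]-no (λ p → <⇒≱ b<a (≤-pred p))) (cong₂ _+_ (sym ([<]-no (<⇒≯ b<a))) (sym (δ-no a≢b)))

rearrangement : ∀ {a b c d} → a ≤ b → c ≤ d → a * d + b * c ≤ a * c + b * d
rearrangement {a} {c = c} a≤b c≤d with m≤n⇒∃[o]m+o≡n a≤b | m≤n⇒∃[o]m+o≡n c≤d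
... | p , refl | q , refl = subst (a * (c + q) + (a + p) * c ≤_) (expand a c p q) (m≤m+n _ (p * q))
  where
  expand : ∀ a c p q → a * (c + q) + (a + p) * c + p * q ≡ a * c + (a + p) * (c + q)
  expand = solve-∀

sum-mono : ∀ {n} {f g : Fin n → ℕ} → (∀ i → f i ≤ g i) → sum f ≤ sum g
sum-mono {zero} _ = z≤n
sum-mono {suc n} f≤g = +-mono-≤ (f≤g F.zero) (sum-mono (f≤g ∘ F.suc))

sum-zero : ∀ {n} {f : Fin n → ℕ} → (∀ i → f i ≡ 0) → sum f ≡ 0
sum-zero {n} f≡0 = trans (sum-cong-≗ f≡0) (sum-replicate-zero n)

sum-support : ∀ {n} (f : Fin n → ℕ) i₀ → (∀ i → i ≢ i₀ → f i ≡ 0) → sum f ≡ f i₀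
sum-support {suc n} f F.zero off =
  trans (cong (f F.zero +_) (sum-zero (λ i → off (F.suc i) λ ()))) (+-identityʳ _)
sum-support {suc n} f (F.suc i₀) off =
  trans (cong (_+ sum (f ∘ F.suc)) (off F.zero λ ()))
        (sum-support (f ∘ F.suc) i₀ (λ i i≢i₀ → off (F.suc i) (i≢i₀ ∘ FP.suc-injective)))

≤-sum : ∀ {n} (f : Fin n → ℕ) i → f i ≤ sum f
≤-sum {suc n} f F.zero = m≤m+n _ _
≤-sum {suc n} f (F.suc i) = ≤-trans (≤-sum (f ∘ F.suc) i) (m≤n+m _ _)

+-≤-sum : ∀ {n} (f : Fin n → ℕ) {i j} → i ≢ j → f i + f j ≤ sum f
+-≤-sum {suc n} f {F.zero} {F.zero} i≢j = ⊥-elim (i≢j refl)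
+-≤-sum {suc n} f {F.zero} {F.suc j} _ = +-monoʳ-≤ (f F.zero) (≤-sum (f ∘ F.suc) j)
+-≤-sum {suc n} f {F.suc i} {F.zero} _ =
  subst (_≤ sum f) (+-comm (f F.zero) _) (+-monoʳ-≤ (f F.zero) (≤-sum (f ∘ F.suc) i))
+-≤-sum {suc n} f {F.suc i} {F.suc j} i≢j =
  ≤-trans (+-≤-sum (f ∘ F.suc) (i≢j ∘ cong F.suc)) (m≤n+m _ _)

sum-positive : ∀ {n} (f : Fin n → ℕ) → 1 ≤ sum f → ∃[ i ] 1 ≤ f i
sum-positive {suc n} f pos with f F.zero in eq
... | suc _ = F.zero , subst (1 ≤_) (sym eq) (s≤s z≤n)
... | zero with sum-positive (f ∘ F.suc) pos
...   | i , 1≤fi = F.suc i , 1≤fi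

count-filter : ∀ {A : Set} {P : A → Set} (P? : ∀ x → Dec (P x)) {n} (g : Fin n → A) →
  length (filter P? (tabulate g)) ≡ sum (λ i → 𝟙 (does (P? (g i))))
count-filter P? {zero} g = refl
count-filter P? {suc n} g with does (P? (g F.zero))
... | true = cong suc (count-filter P? (g ∘ F.suc))
... | false = count-filter P? (g ∘ F.suc)

module _ {n : ℕ} where

  prefixSum : ℕ → (Fin n → ℕ) → ℕ
  prefixSum j g = sum (λ i → [ toℕ i < j ] * g i)

  prefixSum-zero : ∀ g → prefixSum 0 g ≡ 0
  prefixSum-zero g = sum-zero (λ i → cong (_* g i) ([<]-no {toℕ i} {0} λ ()))

  prefixSum-suc : ∀ j (j<n : j < n) g → prefixSum (suc j) g ≡ prefixSum j g + g (fromℕ< j<n)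
  prefixSum-suc j j<n g = begin
      prefixSum (suc j) g
    ≡⟨ sum-cong-≗ (λ i → trans (cong (_* g i) ([<]-suc (toℕ i) j))
                               (*-distribʳ-+ (g i) [ toℕ i < j ] _)) ⟩
      sum (λ i → [ toℕ i < j ] * g i + δ (toℕ i) j * g i)
    ≡⟨ ∑-distrib-+ (λ i → [ toℕ i < j ] * g i) (λ i → δ (toℕ i) j * g i) ⟩
      prefixSum j g + sum (λ i → δ (toℕ i) j * g i)
    ≡⟨ cong (prefixSum j g +_)
            (sum-support _ j′ (λ i i≢j′ → cong (_* g i) (δ-no (i≢j′ ∘ toℕ≡j)))) ⟩
      prefixSum j g + δ (toℕ j′) j * g j′
    ≡⟨ cong (λ z → prefixSum j g + z * g j′) (δ-yes (FP.toℕ-fromℕ< j<n)) ⟩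
      prefixSum j g + (g j′ + 0)
    ≡⟨ cong (prefixSum j g +_) (+-identityʳ _) ⟩
      prefixSum j g + g j′ ∎
    where
    open ≡-Reasoning
    j′ = fromℕ< j<n
    toℕ≡j : ∀ {i} → toℕ i ≡ j → i ≡ j′
    toℕ≡j e = FP.toℕ-injective (trans e (sym (FP.toℕ-fromℕ< j<n)))

  prefixSum-all : ∀ g → prefixSum n g ≡ sum g
  prefixSum-all g = sum-cong-≗ (λ i → trans (cong (_* g i) ([<]-yes (FP.toℕ<n i))) (+-identityʳ _))

  prefixSum-+ : ∀ j g h → prefixSum j (λ i → g i + h i) ≡ prefixSum j g + prefixSum j h
  prefixSum-+ j g h = trans (sum-cong-≗ (λ i → *-distribˡ-+ [ toℕ i < j ] (g i) (h i)))
    (∑-distrib-+ (λ i → [ toℕ i < j ] * g i) (λ i → [ toℕ i < j ] * h i))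

  prefixSum-1 : ∀ j → j ≤ n → prefixSum j (λ _ → 1) ≡ j
  prefixSum-1 zero _ = prefixSum-zero (λ _ → 1)
  prefixSum-1 (suc j) j<n =
    trans (prefixSum-suc j j<n _) (trans (cong (_+ 1) (prefixSum-1 j (<⇒≤ j<n))) (+-comm j 1))

  rankF : (Fin n → Fin n) → ℕ → ℕ → ℕ
  rankF f j r = prefixSum j (λ i → [ toℕ (f i) < r ])

  column : (Fin n → Fin n) → ℕ → ℕ → ℕ
  column f j v = prefixSum j (λ i → δ (toℕ (f i)) v)

  module _ (f : Fin n → Fin n) where

    rankF-zeroˡ : ∀ r → rankF f 0 r ≡ 0
    rankF-zeroˡ r = prefixSum-zero (λ i → [ toℕ (f i) < r ])

    rankF-zeroʳ : ∀ j → rankF f j 0 ≡ 0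
    rankF-zeroʳ j = sum-zero (λ i →
      trans (cong ([ toℕ i < j ] *_) ([<]-no {toℕ (f i)} {0} λ ())) (*-zeroʳ [ toℕ i < j ]))

    rankF-sucˡ : ∀ j (j<n : j < n) r → rankF f (suc j) r ≡ rankF f j r + [ toℕ (f (fromℕ< j<n)) < r ]
    rankF-sucˡ j j<n r = prefixSum-suc j j<n _

    rankF-sucʳ : ∀ j v → rankF f j (suc v) ≡ rankF f j v + column f j v
    rankF-sucʳ j v =
      trans (sum-cong-≗ (λ i → cong ([ toℕ i < j ] *_) ([<]-suc (toℕ (f i)) v))) (prefixSum-+ j _ _)

    rankF-allʳ : ∀ j → j ≤ n → rankF f j n ≡ j
    rankF-allʳ j j≤n =
      trans (sum-cong-≗ (λ i → cong ([ toℕ i < j ] *_) ([<]-yes (FP.toℕ<n (f i))))) (prefixSum-1 j j≤n)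

    rankF-monoˡ : ∀ {j₁ j₂} r → j₁ ≤ j₂ → rankF f j₁ r ≤ rankF f j₂ r
    rankF-monoˡ r j₁≤j₂ = sum-mono (λ i → *-monoˡ-≤ [ toℕ (f i) < r ] ([<]-mono (toℕ i) j₁≤j₂))

    rankF-monoʳ : ∀ j {r₁ r₂} → r₁ ≤ r₂ → rankF f j r₁ ≤ rankF f j r₂
    rankF-monoʳ j r₁≤r₂ = sum-mono (λ i → *-monoʳ-≤ [ toℕ i < j ] ([<]-mono (toℕ (f i)) r₁≤r₂))

    rankF-quadrangle : ∀ {j₁ j₂ r₁ r₂} → j₁ ≤ j₂ → r₁ ≤ r₂ →
      rankF f j₁ r₂ + rankF f j₂ r₁ ≤ rankF f j₁ r₁ + rankF f j₂ r₂
    rankF-quadrangle {j₁} {j₂} {r₁} {r₂} j₁≤j₂ r₁≤r₂ = begin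
        rankF f j₁ r₂ + rankF f j₂ r₁
      ≡⟨ ∑-distrib-+ (λ i → [ toℕ i < j₁ ] * [ toℕ (f i) < r₂ ])
                     (λ i → [ toℕ i < j₂ ] * [ toℕ (f i) < r₁ ]) ⟨
        sum (λ i → [ toℕ i < j₁ ] * [ toℕ (f i) < r₂ ] + [ toℕ i < j₂ ] * [ toℕ (f i) < r₁ ])
      ≤⟨ sum-mono (λ i → rearrangement ([<]-mono (toℕ i) j₁≤j₂)
                                         ([<]-mono (toℕ (f i)) r₁≤r₂)) ⟩
        sum (λ i → [ toℕ i < j₁ ] * [ toℕ (f i) < r₁ ] + [ toℕ i < j₂ ] * [ toℕ (f i) < r₂ ])
      ≡⟨ ∑-distrib-+ (λ i → [ toℕ i < j₁ ] * [ toℕ (f i) < r₁ ])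
                     (λ i → [ toℕ i < j₂ ] * [ toℕ (f i) < r₂ ]) ⟩
        rankF f j₁ r₁ + rankF f j₂ r₂ ∎
      where open ≤-Reasoning

module _ {n : ℕ} where

  rk : Permutation′ n → ℕ → ℕ → ℕ
  rk μ = rankF (μ ⟨$⟩ʳ_)

  rank≡rk : ∀ (μ : Permutation′ n) k r → rank μ k r ≡ rk μ k r
  rank≡rk μ k r = trans (count-filter _ {n} id)
    (sum-cong-≗ (λ i → 𝟙-∧ (does (toℕ i <? k)) (does (toℕ (μ ⟨$⟩ʳ i) <? r))))

  column-perm : ∀ (μ : Permutation′ n) k r (r<n : r < n) →
    column (μ ⟨$⟩ʳ_) k r ≡ [ toℕ (μ ⟨$⟩ˡ fromℕ< r<n) < k ]
  column-perm μ k r r<n =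
    trans (sum-support _ i₀ off)
          (trans (cong ([ toℕ i₀ < k ] *_) (δ-yes hit)) (*-identityʳ [ toℕ i₀ < k ]))
    where
    i₀ = μ ⟨$⟩ˡ fromℕ< r<n
    hit : toℕ (μ ⟨$⟩ʳ i₀) ≡ r
    hit = trans (cong toℕ (inverseʳ μ)) (FP.toℕ-fromℕ< r<n)
    off : ∀ i → i ≢ i₀ → [ toℕ i < k ] * δ (toℕ (μ ⟨$⟩ʳ i)) r ≡ 0
    off i i≢i₀ = trans (cong ([ toℕ i < k ] *_) (δ-no (i≢i₀ ∘ preimage))) (*-zeroʳ [ toℕ i < k ])
      where
      preimage : toℕ (μ ⟨$⟩ʳ i) ≡ r → i ≡ i₀
      preimage e = trans (sym (inverseˡ μ))
        (cong (μ ⟨$⟩ˡ_) (FP.toℕ-injective (trans e (sym (FP.toℕ-fromℕ< r<n)))))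

  rk-allˡ : ∀ μ r → r ≤ n → rk μ n r ≡ r
  rk-allˡ μ zero _ = rankF-zeroʳ (μ ⟨$⟩ʳ_) n
  rk-allˡ μ (suc r) r<n = begin
      rk μ n (suc r)                   ≡⟨ rankF-sucʳ (μ ⟨$⟩ʳ_) n r ⟩
      rk μ n r + column (μ ⟨$⟩ʳ_) n r   ≡⟨ cong₂ _+_ (rk-allˡ μ r (<⇒≤ r<n)) (column-perm μ n r r<n) ⟩
      r + [ toℕ (μ ⟨$⟩ˡ v) < n ]       ≡⟨ cong (r +_) ([<]-yes (FP.toℕ<n (μ ⟨$⟩ˡ v))) ⟩
      r + 1                            ≡⟨ +-comm r 1 ⟩
      suc r                            ∎
    where
    open ≡-Reasoning
    v = fromℕ< r<n

  -- The rank criterion of _≤B_ over the closed grid: on its border all permutations agree.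
  _⊑_ : Permutation′ n → Permutation′ n → Set
  σ ⊑ μ = ∀ j r → j ≤ n → r ≤ n → rk μ j r ≤ rk σ j r

  ≤B⇒⊑ : ∀ {σ μ : Permutation′ n} → σ ≤B μ → σ ⊑ μ
  ≤B⇒⊑ {σ} {μ} σ≤μ zero r _ _ =
    ≤-reflexive (trans (rankF-zeroˡ (μ ⟨$⟩ʳ_) r) (sym (rankF-zeroˡ (σ ⟨$⟩ʳ_) r)))
  ≤B⇒⊑ {σ} {μ} σ≤μ (suc j) zero _ _ =
    ≤-reflexive (trans (rankF-zeroʳ (μ ⟨$⟩ʳ_) (suc j)) (sym (rankF-zeroʳ (σ ⟨$⟩ʳ_) (suc j))))
  ≤B⇒⊑ {σ} {μ} σ≤μ (suc j) (suc r) j≤n r≤n with suc j ≟ n | suc r ≟ n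
  ... | yes refl | _ = ≤-reflexive (trans (rk-allˡ μ _ r≤n) (sym (rk-allˡ σ _ r≤n)))
  ... | no _ | yes refl =
    ≤-reflexive (trans (rankF-allʳ (μ ⟨$⟩ʳ_) _ j≤n) (sym (rankF-allʳ (σ ⟨$⟩ʳ_) _ j≤n)))
  ... | no j≢n | no r≢n = subst₂ _≤_ (rank≡rk μ (suc j) (suc r)) (rank≡rk σ (suc j) (suc r))
          (σ≤μ (suc r) (suc j) (s≤s z≤n) (≤∧≢⇒< r≤n r≢n) (s≤s z≤n) (≤∧≢⇒< j≤n j≢n))

  ⊑⇒≤B : ∀ {σ μ : Permutation′ n} → σ ⊑ μ → σ ≤B μ
  ⊑⇒≤B {σ} {μ} σ⊑μ r j _ r<n _ j<n =
    subst₂ _≤_ (sym (rank≡rk μ j r)) (sym (rank≡rk σ j r)) (σ⊑μ j r (<⇒≤ j<n) (<⇒≤ r<n))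

  ≤B-refl : ∀ {σ : Permutation′ n} → σ ≤B σ
  ≤B-refl _ _ _ _ _ _ = ≤-refl

  ≤B-trans : ∀ {σ μ ν : Permutation′ n} → σ ≤B μ → μ ≤B ν → σ ≤B ν
  ≤B-trans σ≤μ μ≤ν r j 1≤r r<n 1≤j j<n =
    ≤-trans (μ≤ν r j 1≤r r<n 1≤j j<n) (σ≤μ r j 1≤r r<n 1≤j j<n)

  SameRow : ℕ → Permutation′ n → Permutation′ n → Set
  SameRow k σ μ = ∀ r → r ≤ n → rk μ k r ≡ rk σ k r

  module _ (μ : Permutation′ n) (k : ℕ) (v : Fin n) where

    prefixImage⇒ : (∃[ i ] (toℕ i < k × μ ⟨$⟩ʳ i ≡ v)) → toℕ (μ ⟨$⟩ˡ v) < k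
    prefixImage⇒ (i , i<k , μi≡v) =
      subst (λ z → toℕ z < k) (trans (sym (inverseˡ μ)) (cong (μ ⟨$⟩ˡ_) μi≡v)) i<k

    ⇒prefixImage : toℕ (μ ⟨$⟩ˡ v) < k → ∃[ i ] (toℕ i < k × μ ⟨$⟩ʳ i ≡ v)
    ⇒prefixImage μ⁻¹v<k = μ ⟨$⟩ˡ v , μ⁻¹v<k , inverseʳ μ

  module _ (k : ℕ) (σ μ : Permutation′ n) where

    InCoset⇒SameRow : InCoset k σ μ → SameRow k σ μ
    InCoset⇒SameRow _ zero _ = trans (rankF-zeroʳ (μ ⟨$⟩ʳ_) k) (sym (rankF-zeroʳ (σ ⟨$⟩ʳ_) k))
    InCoset⇒SameRow coset (suc r) r<n = begin
        rk μ k (suc r)                       ≡⟨ rankF-sucʳ (μ ⟨$⟩ʳ_) k r ⟩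
        rk μ k r + column (μ ⟨$⟩ʳ_) k r       ≡⟨ cong₂ _+_ (InCoset⇒SameRow coset r (<⇒≤ r<n))
                                                            (column-perm μ k r r<n) ⟩
        rk σ k r + [ toℕ (μ ⟨$⟩ˡ v) < k ]    ≡⟨ cong (rk σ k r +_) ([<]-cong μ⇒σ σ⇒μ) ⟩
        rk σ k r + [ toℕ (σ ⟨$⟩ˡ v) < k ]    ≡⟨ cong (rk σ k r +_) (column-perm σ k r r<n) ⟨
        rk σ k r + column (σ ⟨$⟩ʳ_) k r       ≡⟨ rankF-sucʳ (σ ⟨$⟩ʳ_) k r ⟨
        rk σ k (suc r)                       ∎
      where
      open ≡-Reasoning
      v = fromℕ< r<n
      μ⇒σ = λ μ⁻¹v<k → prefixImage⇒ σ k v (proj₁ (coset v) (⇒prefixImage μ k v μ⁻¹v<k))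
      σ⇒μ = λ σ⁻¹v<k → prefixImage⇒ μ k v (proj₂ (coset v) (⇒prefixImage σ k v σ⁻¹v<k))

    SameRow⇒InCoset : SameRow k σ μ → InCoset k σ μ
    SameRow⇒InCoset same v =
        (λ hit → ⇒prefixImage σ k v ([<]≡1⇒< (trans (sym columns≡) ([<]-yes (prefixImage⇒ μ k v hit)))))
      , (λ hit → ⇒prefixImage μ k v ([<]≡1⇒< (trans columns≡ ([<]-yes (prefixImage⇒ σ k v hit)))))
      where
      r = toℕ v
      r<n = FP.toℕ<n v
      fromℕ<r≡v : fromℕ< r<n ≡ v
      fromℕ<r≡v = FP.fromℕ<-toℕ v r<n
      column≡ : column (μ ⟨$⟩ʳ_) k r ≡ column (σ ⟨$⟩ʳ_) k r
      column≡ = +-cancelˡ-≡ (rk μ k r) _ _ (begin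
          rk μ k r + column (μ ⟨$⟩ʳ_) k r  ≡⟨ rankF-sucʳ (μ ⟨$⟩ʳ_) k r ⟨
          rk μ k (suc r)                  ≡⟨ same (suc r) r<n ⟩
          rk σ k (suc r)                  ≡⟨ rankF-sucʳ (σ ⟨$⟩ʳ_) k r ⟩
          rk σ k r + column (σ ⟨$⟩ʳ_) k r  ≡⟨ cong (_+ column (σ ⟨$⟩ʳ_) k r) (same r (<⇒≤ r<n)) ⟨
          rk μ k r + column (σ ⟨$⟩ʳ_) k r  ∎)
        where open ≡-Reasoning
      columns≡ : [ toℕ (μ ⟨$⟩ˡ v) < k ] ≡ [ toℕ (σ ⟨$⟩ˡ v) < k ]
      columns≡ = subst (λ w → [ toℕ (μ ⟨$⟩ˡ w) < k ] ≡ [ toℕ (σ ⟨$⟩ˡ w) < k ]) fromℕ<r≡v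
        (trans (sym (column-perm μ k r r<n)) (trans column≡ (column-perm σ k r r<n)))

Jump : ℕ → ℕ → Set
Jump a b = b ≡ suc a

Δ01 : ℕ → ℕ → Set
Δ01 a b = b ≡ a ⊎ Jump a b

module _ {P : ℕ → Set} (P? : ∀ x → Dec (P x)) where

  least? : ∀ m → (∃[ x ] (x < m × P x × (∀ y → y < x → ¬ P y))) ⊎ (∀ y → y < m → ¬ P y)
  least? zero = inj₂ (λ _ ())
  least? (suc m) with least? m
  ... | inj₁ (x , x<m , Px , below) = inj₁ (x , m<n⇒m<1+n x<m , Px , below)
  ... | inj₂ none with P? m
  ...   | yes Pm = inj₁ (m , n<1+n m , Pm , none)
  ...   | no ¬Pm = inj₂ (λ y y<1+m →
    [ none y , (λ { refl → ¬Pm }) ]′ (m≤n⇒m<n∨m≡n (≤-pred y<1+m)))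

-- A grid function with the border values and the increments of a rank function is one: row
-- j+1 exceeds row j exactly at the values r > entry j, and j ↦ entry j is the permutation.
module Realization (n : ℕ) (R : ℕ → ℕ → ℕ)
  (R-row₀ : ∀ r → r ≤ n → R 0 r ≡ 0)
  (R-col₀ : ∀ j → j ≤ n → R j 0 ≡ 0)
  (R-colₙ : ∀ j → j ≤ n → R j n ≡ j)
  (R-rowₙ : ∀ r → r ≤ n → R n r ≡ r)
  (R-step : ∀ j → j < n → ∀ r → r ≤ n → Δ01 (R j r) (R (suc j) r))
  (R-jump-persists : ∀ j → j < n → ∀ r → r < n →
     Jump (R j r) (R (suc j) r) → Jump (R j (suc r)) (R (suc j) (suc r)))
  where

  Jumps : ℕ → ℕ → Set
  Jumps j r = Jump (R j (suc r)) (R (suc j) (suc r))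

  entry : ℕ → ℕ
  entry j with least? (λ r → R (suc j) (suc r) ≟ suc (R j (suc r))) n
  ... | inj₁ (x , _) = x
  ... | inj₂ _ = 0

  entry-least : ∀ j → j < n → entry j < n × Jumps j (entry j) × (∀ y → y < entry j → ¬ Jumps j y)
  entry-least j j<n with least? (λ r → R (suc j) (suc r) ≟ suc (R j (suc r))) n
  ... | inj₁ (_ , x<n , jumps , below) = x<n , jumps , below
  ... | inj₂ none = ⊥-elim (none (pred n) (≤-reflexive 1+pred≡n) jumps-at-n)
    where
    1+pred≡n : suc (pred n) ≡ n
    1+pred≡n = suc-pred n {{>-nonZero (<-≤-trans z<s j<n)}}
    jumps-at-n : Jumps j (pred n)
    jumps-at-n = subst (λ z → Jump (R j z) (R (suc j) z)) (sym 1+pred≡n)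
      (trans (R-colₙ (suc j) j<n) (cong suc (sym (R-colₙ j (<⇒≤ j<n)))))

  jumps-from-entry : ∀ j → j < n → ∀ d → entry j + d < n → Jumps j (entry j + d)
  jumps-from-entry j j<n zero _ =
    subst (Jumps j) (sym (+-identityʳ (entry j))) (proj₁ (proj₂ (entry-least j j<n)))
  jumps-from-entry j j<n (suc d) x+1+d<n = subst (Jumps j) (sym (+-suc (entry j) d))
    (R-jump-persists j j<n (suc (entry j + d)) 1+x+d<n
      (jumps-from-entry j j<n d (<-trans (n<1+n _) 1+x+d<n)))
    where
    1+x+d<n : suc (entry j + d) < n
    1+x+d<n = subst (_< n) (+-suc (entry j) d) x+1+d<n

  R-sucˡ : ∀ j → j < n → ∀ r → r ≤ n → R (suc j) r ≡ R j r + [ entry j < r ]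
  R-sucˡ j j<n zero _ =
    trans (R-col₀ (suc j) j<n) (sym (cong₂ _+_ (R-col₀ j (<⇒≤ j<n)) ([<]-no {entry j} {0} λ ())))
  R-sucˡ j j<n (suc y) 1+y≤n with y <? entry j
  ... | yes y<x = begin
      R (suc j) (suc y)     ≡⟨ [ id , (λ jump → ⊥-elim (proj₂ (proj₂ (entry-least j j<n)) y y<x jump)) ]′
                                 (R-step j j<n (suc y) 1+y≤n) ⟩
      R j (suc y)           ≡⟨ +-identityʳ _ ⟨
      R j (suc y) + 0       ≡⟨ cong (R j (suc y) +_) ([<]-no (<⇒≱ y<x ∘ ≤-pred)) ⟨
      R j (suc y) + [ entry j < suc y ] ∎
    where open ≡-Reasoning
  ... | no y≮x = begin
      R (suc j) (suc y)     ≡⟨ subst (Jumps j) (m+[n∸m]≡n x≤y)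
                                   (jumps-from-entry j j<n (y ∸ entry j) x+[y∸x]<n) ⟩
      suc (R j (suc y))     ≡⟨ +-comm 1 _ ⟩
      R j (suc y) + 1       ≡⟨ cong (R j (suc y) +_) ([<]-yes (s≤s x≤y)) ⟨
      R j (suc y) + [ entry j < suc y ] ∎
    where
    open ≡-Reasoning
    x≤y = ≮⇒≥ y≮x
    x+[y∸x]<n = subst (_< n) (sym (m+[n∸m]≡n x≤y)) 1+y≤n

  b : Fin n → Fin n
  b i = fromℕ< (proj₁ (entry-least (toℕ i) (FP.toℕ<n i)))

  rankF-b : ∀ j r → j ≤ n → r ≤ n → rankF b j r ≡ R j r
  rankF-b zero r _ r≤n = trans (rankF-zeroˡ b r) (sym (R-row₀ r r≤n))
  rankF-b (suc j) r j<n r≤n = begin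
      rankF b (suc j) r                          ≡⟨ rankF-sucˡ b j j<n r ⟩
      rankF b j r + [ toℕ (b (fromℕ< j<n)) < r ] ≡⟨ cong₂ _+_ (rankF-b j r (<⇒≤ j<n) r≤n)
                                                               (cong [_< r ] toℕ-b) ⟩
      R j r + [ entry j < r ]                    ≡⟨ R-sucˡ j j<n r r≤n ⟨
      R (suc j) r                                ∎
    where
    open ≡-Reasoning
    toℕ-b : toℕ (b (fromℕ< j<n)) ≡ entry j
    toℕ-b = trans (FP.toℕ-fromℕ< _) (cong entry (FP.toℕ-fromℕ< j<n))

  each-value-once : ∀ v → v < n → sum (λ i → δ (toℕ (b i)) v) ≡ 1
  each-value-once v v<n = +-cancelˡ-≡ v _ _ (begin
      v + sum (λ i → δ (toℕ (b i)) v) ≡⟨ cong₂ _+_ (rankF-b-rowₙ v (<⇒≤ v<n))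
                                                    (prefixSum-all (λ i → δ (toℕ (b i)) v)) ⟨
      rankF b n v + column b n v      ≡⟨ rankF-sucʳ b n v ⟨
      rankF b n (suc v)               ≡⟨ rankF-b-rowₙ (suc v) v<n ⟩
      suc v                           ≡⟨ +-comm 1 v ⟩
      v + 1                           ∎)
    where
    open ≡-Reasoning
    rankF-b-rowₙ : ∀ r → r ≤ n → rankF b n r ≡ r
    rankF-b-rowₙ r r≤n = trans (rankF-b n r ≤-refl r≤n) (R-rowₙ r r≤n)

  preimage : ∀ v → ∃[ i ] 1 ≤ δ (toℕ (b i)) (toℕ v)
  preimage v = sum-positive (λ i → δ (toℕ (b i)) (toℕ v))
    (≤-reflexive (sym (each-value-once (toℕ v) (FP.toℕ<n v))))

  b⁻¹ : Fin n → Fin n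
  b⁻¹ v = proj₁ (preimage v)

  b∘b⁻¹ : ∀ v → b (b⁻¹ v) ≡ v
  b∘b⁻¹ v = FP.toℕ-injective (1≤δ⇒≡ (proj₂ (preimage v)))

  b-injective : ∀ {i₁ i₂} → b i₁ ≡ b i₂ → i₁ ≡ i₂
  b-injective {i₁} {i₂} bi₁≡bi₂ with i₁ FP.≟ i₂
  ... | yes i₁≡i₂ = i₁≡i₂
  ... | no i₁≢i₂ = ⊥-elim (1+n≰n (begin
      2                                    ≡⟨ cong₂ _+_ (δ-yes (cong toℕ bi₁≡bi₂)) (δ-yes {v} refl) ⟨
      δ (toℕ (b i₁)) v + δ (toℕ (b i₂)) v  ≤⟨ +-≤-sum (λ i → δ (toℕ (b i)) v) i₁≢i₂ ⟩
      sum (λ i → δ (toℕ (b i)) v)          ≡⟨ each-value-once v (FP.toℕ<n (b i₂)) ⟩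
      1                                    ∎))
    where
    open ≤-Reasoning
    v = toℕ (b i₂)

  realization : ∃[ μ ] (∀ j r → j ≤ n → r ≤ n → rk μ j r ≡ R j r)
  realization = permutation b b⁻¹ b∘b⁻¹ (λ i → b-injective (b∘b⁻¹ (b i))) , rankF-b

Δ01-bounds : ∀ {a b} → Δ01 a b → a ≤ b × b ≤ suc a
Δ01-bounds (inj₁ refl) = ≤-refl , n≤1+n _
Δ01-bounds (inj₂ refl) = n≤1+n _ , ≤-refl

bounds-Δ01 : ∀ {a b} → a ≤ b → b ≤ suc a → Δ01 a b
bounds-Δ01 a≤b b≤1+a with m≤n⇒m<n∨m≡n b≤1+a
... | inj₁ b<1+a = inj₁ (≤-antisym (≤-pred b<1+a) a≤b)
... | inj₂ b≡1+a = inj₂ b≡1+a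

⊔-Δ01 : ∀ {a a′ b b′} → Δ01 a a′ → Δ01 b b′ → Δ01 (a ⊔ b) (a′ ⊔ b′)
⊔-Δ01 Δa Δb with Δ01-bounds Δa | Δ01-bounds Δb
... | a≤a′ , a′≤1+a | b≤b′ , b′≤1+b =
  bounds-Δ01 (⊔-mono-≤ a≤a′ b≤b′) (⊔-mono-≤ a′≤1+a b′≤1+b)

module _ {a b : ℕ} (c m : ℕ) (m≤a+c : m ≤ a + c) where

  +-∸-jump : Jump a b → Jump ((a + c) ∸ m) ((b + c) ∸ m)
  +-∸-jump refl = +-∸-assoc 1 m≤a+c

  +-∸-Δ01 : Δ01 a b → Δ01 ((a + c) ∸ m) ((b + c) ∸ m)
  +-∸-Δ01 (inj₁ refl) = inj₁ refl
  +-∸-Δ01 (inj₂ b≡1+a) = inj₂ (+-∸-jump b≡1+a)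

  +-∸-jump⁻¹ : Δ01 a b → Jump ((a + c) ∸ m) ((b + c) ∸ m) → Jump a b
  +-∸-jump⁻¹ (inj₁ refl) jump = ⊥-elim (1+n≢n (sym jump))
  +-∸-jump⁻¹ (inj₂ b≡1+a) _ = b≡1+a

maxUpTo : (ℕ → ℕ) → ℕ → ℕ
maxUpTo g zero = g zero
maxUpTo g (suc r) = maxUpTo g r ⊔ g (suc r)

maxFrom : (ℕ → ℕ) → ℕ → ℕ → ℕ
maxFrom g r zero = g r
maxFrom g r (suc d) = g r ⊔ maxFrom g (suc r) d

≤-maxUpTo : ∀ g {r x} → x ≤ r → g x ≤ maxUpTo g r
≤-maxUpTo g {zero} z≤n = ≤-refl
≤-maxUpTo g {suc r} x≤1+r with m≤n⇒m<n∨m≡n x≤1+r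
... | inj₁ x<1+r = ≤-trans (≤-maxUpTo g (≤-pred x<1+r)) (m≤m⊔n _ _)
... | inj₂ refl = m≤n⊔m _ _

maxUpTo-+-lub : ∀ g r {a c} → (∀ x → x ≤ r → g x + a ≤ c) → maxUpTo g r + a ≤ c
maxUpTo-+-lub g zero bound = bound 0 z≤n
maxUpTo-+-lub g (suc r) {a} bound = subst (_≤ _) (sym (+-distribʳ-⊔ a (maxUpTo g r) (g (suc r))))
  (⊔-lub (maxUpTo-+-lub g r (λ x x≤r → bound x (m≤n⇒m≤1+n x≤r))) (bound (suc r) ≤-refl))

≤-maxFrom : ∀ g {r} d {x} → r ≤ x → x ≤ r + d → g x ≤ maxFrom g r d
≤-maxFrom g {r} zero r≤x x≤r+0 =
  ≤-reflexive (cong g (≤-antisym (subst (_ ≤_) (+-identityʳ r) x≤r+0) r≤x))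
≤-maxFrom g {r} (suc d) {x} r≤x x≤r+1+d with m≤n⇒m<n∨m≡n r≤x
... | inj₂ refl = m≤m⊔n _ _
... | inj₁ r<x = ≤-trans (≤-maxFrom g d r<x (subst (x ≤_) (+-suc r d) x≤r+1+d)) (m≤n⊔m _ _)

maxFrom-+-lub : ∀ g r d {a c} → (∀ x → r ≤ x → x ≤ r + d → g x + a ≤ c) → maxFrom g r d + a ≤ c
maxFrom-+-lub g r zero bound = bound r ≤-refl (m≤m+n r 0)
maxFrom-+-lub g r (suc d) {a} bound = subst (_≤ _) (sym (+-distribʳ-⊔ a (g r) (maxFrom g (suc r) d)))
  (⊔-lub (bound r ≤-refl (m≤m+n r _))
         (maxFrom-+-lub g (suc r) d
           (λ x r<x x≤ → bound x (<⇒≤ r<x) (subst (x ≤_) (sym (+-suc r d)) x≤))))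

maxUpTo-+-attained : ∀ g r {a c x} → (∀ y → y ≤ r → g y + a ≤ c) → x ≤ r → c ≤ g x + a →
  maxUpTo g r + a ≡ c
maxUpTo-+-attained g r {a} bound x≤r c≤ =
  ≤-antisym (maxUpTo-+-lub g r bound) (≤-trans c≤ (+-monoˡ-≤ a (≤-maxUpTo g x≤r)))

Bump : (ℕ → ℕ) → (ℕ → ℕ) → ℕ → Set
Bump g g′ v = ∀ x → (g′ x ≡ g x × x ≤ v) ⊎ (g′ x ≡ suc (g x) × v < x)

module _ {g g′ : ℕ → ℕ} {v : ℕ} (bump : Bump g g′ v) where

  bump-Δ01 : ∀ x → Δ01 (g x) (g′ x)
  bump-Δ01 x = Sum.map proj₁ proj₁ (bump x)

  maxUpTo-bump : ∀ r → Δ01 (maxUpTo g r) (maxUpTo g′ r)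
  maxUpTo-bump zero = bump-Δ01 0
  maxUpTo-bump (suc r) = ⊔-Δ01 (maxUpTo-bump r) (bump-Δ01 (suc r))

  maxUpTo-bump-below : ∀ r → r ≤ v → maxUpTo g′ r ≡ maxUpTo g r
  maxUpTo-bump-below r r≤v with bump r
  ... | inj₂ (_ , v<r) = ⊥-elim (<⇒≱ v<r r≤v)
  maxUpTo-bump-below zero _ | inj₁ (same , _) = same
  maxUpTo-bump-below (suc r) r≤v | inj₁ (same , _) = cong₂ _⊔_ (maxUpTo-bump-below r (<⇒≤ r≤v)) same

  maxUpTo-jump-persists : ∀ r → Jump (maxUpTo g r) (maxUpTo g′ r) →
    Jump (maxUpTo g (suc r)) (maxUpTo g′ (suc r))
  maxUpTo-jump-persists r jump with r ≤? v | bump (suc r)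
  ... | yes r≤v | _ = ⊥-elim (1+n≢n (trans (sym jump) (maxUpTo-bump-below r r≤v)))
  ... | no r≰v | inj₁ (_ , 1+r≤v) = ⊥-elim (r≰v (<⇒≤ 1+r≤v))
  ... | no _ | inj₂ (bumped , _) = cong₂ _⊔_ jump bumped

  maxFrom-bump : ∀ r d → Δ01 (maxFrom g r d) (maxFrom g′ r d)
  maxFrom-bump r zero = bump-Δ01 r
  maxFrom-bump r (suc d) = ⊔-Δ01 (bump-Δ01 r) (maxFrom-bump (suc r) d)

  maxFrom-bump-above : ∀ r d → v < r → maxFrom g′ r d ≡ suc (maxFrom g r d)
  maxFrom-bump-above r d v<r with bump r
  ... | inj₁ (_ , r≤v) = ⊥-elim (<⇒≱ v<r r≤v)
  maxFrom-bump-above r zero _ | inj₂ (bumped , _) = bumped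
  maxFrom-bump-above r (suc d) v<r | inj₂ (bumped , _) =
    cong₂ _⊔_ bumped (maxFrom-bump-above (suc r) d (m<n⇒m<1+n v<r))

  maxFrom-jump-persists : ∀ r d → Jump (maxFrom g r (suc d)) (maxFrom g′ r (suc d)) →
    Jump (maxFrom g (suc r) d) (maxFrom g′ (suc r) d)
  maxFrom-jump-persists r d jump with v <? r
  ... | yes v<r = maxFrom-bump-above (suc r) d (m<n⇒m<1+n v<r)
  ... | no v≮r with bump r | maxFrom-bump (suc r) d
  ...   | inj₂ (_ , v<r) | _ = ⊥-elim (v≮r v<r)
  ...   | inj₁ _ | inj₂ rest-jumps = rest-jumps
  ...   | inj₁ (same , _) | inj₁ rest-same = ⊥-elim (1+n≢n (trans (sym jump) (cong₂ _⊔_ same rest-same)))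

module MaximalElement {n : ℕ} (σ ν : Permutation′ n) (k : ℕ) (k≤n : k ≤ n) (σ⊑ν : σ ⊑ ν) where

  A : ℕ → ℕ
  A = rk σ k

  -- G j y is rk ν j y − A y shifted by n to stay in ℕ; R removes the shift again.
  G : ℕ → ℕ → ℕ
  G j y = rk ν j y + (n ∸ A y)

  suffixMax : (ℕ → ℕ) → ℕ → ℕ
  suffixMax g r = maxFrom g r (n ∸ r)

  ≤-suffixMax : ∀ g {r x} → r ≤ x → x ≤ n → g x ≤ suffixMax g r
  ≤-suffixMax g {r} r≤x x≤n = ≤-maxFrom g (n ∸ r) r≤x (≤-trans x≤n (m≤n+m∸n n r))

  suffixMax-+-lub : ∀ g {r a c} → r ≤ n → (∀ y → r ≤ y → y ≤ n → g y + a ≤ c) →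
    suffixMax g r + a ≤ c
  suffixMax-+-lub g {r} r≤n bound =
    maxFrom-+-lub g r (n ∸ r) (λ y r≤y y≤ → bound y r≤y (subst (y ≤_) (m+[n∸m]≡n r≤n) y≤))

  suffixMax-+-attained : ∀ g {r a c x} → r ≤ n → (∀ y → r ≤ y → y ≤ n → g y + a ≤ c) →
    r ≤ x → x ≤ n → c ≤ g x + a → suffixMax g r + a ≡ c
  suffixMax-+-attained g {a = a} r≤n bound r≤x x≤n c≤ =
    ≤-antisym (suffixMax-+-lub g r≤n bound) (≤-trans c≤ (+-monoˡ-≤ a (≤-suffixMax g r≤x x≤n)))

  M : ℕ → ℕ → ℕ
  M j r with j ≤? k
  ... | yes _ = suffixMax (G j) r
  ... | no _ = maxUpTo (G j) r

  R : ℕ → ℕ → ℕ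
  R j r = (M j r + A r) ∸ n

  A≤n : ∀ x → x ≤ n → A x ≤ n
  A≤n x x≤n = begin
    A x   ≤⟨ rankF-monoʳ (σ ⟨$⟩ʳ_) k x≤n ⟩
    A n   ≡⟨ rankF-allʳ (σ ⟨$⟩ʳ_) k k≤n ⟩
    k     ≤⟨ k≤n ⟩
    n     ∎
    where open ≤-Reasoning

  A+[n∸A] : ∀ x → x ≤ n → A x + (n ∸ A x) ≡ n
  A+[n∸A] x x≤n = m+[n∸m]≡n (A≤n x x≤n)

  A-slope : ∀ {x r} → x ≤ r → r ≤ n → A r + x ≤ A x + r
  A-slope {x} {r} x≤r r≤n =
    subst₂ (λ u w → A r + u ≤ A x + w) (rk-allˡ σ x (≤-trans x≤r r≤n)) (rk-allˡ σ r r≤n)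
      (rankF-quadrangle (σ ⟨$⟩ʳ_) k≤n x≤r)

  G+A≡ : ∀ j r → r ≤ n → G j r + A r ≡ rk ν j r + n
  G+A≡ j r r≤n = trans (reorder (rk ν j r) (n ∸ A r) (A r)) (cong (rk ν j r +_) (A+[n∸A] r r≤n))
    where
    reorder : ∀ a b c → a + b + c ≡ a + (c + b)
    reorder = solve-∀

  G+A≤ : ∀ j {y r} → r ≤ y → y ≤ n → G j y + A r ≤ rk ν j y + n
  G+A≤ j {y} r≤y y≤n =
    ≤-trans (+-monoʳ-≤ (G j y) (rankF-monoʳ (σ ⟨$⟩ʳ_) k r≤y)) (≤-reflexive (G+A≡ j y y≤n))

  G≤n : ∀ {j x} → j ≤ k → x ≤ n → G j x ≤ n
  G≤n {j} {x} j≤k x≤n = begin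
      rk ν j x + (n ∸ A x) ≤⟨ +-monoˡ-≤ (n ∸ A x) (rankF-monoˡ (ν ⟨$⟩ʳ_) x j≤k) ⟩
      rk ν k x + (n ∸ A x) ≤⟨ +-monoˡ-≤ (n ∸ A x) (σ⊑ν k x k≤n x≤n) ⟩
      A x + (n ∸ A x)      ≡⟨ A+[n∸A] x x≤n ⟩
      n                    ∎
    where open ≤-Reasoning

  G+k≤j+n : ∀ {j x} → k ≤ j → j ≤ n → x ≤ n → G j x + k ≤ j + n
  G+k≤j+n {j} {x} k≤j j≤n x≤n = begin
      rk ν j x + t + k      ≡⟨ reorder₁ (rk ν j x) t k ⟩
      (k + rk ν j x) + t    ≡⟨ cong (λ z → (z + rk ν j x) + t) (rankF-allʳ (ν ⟨$⟩ʳ_) k k≤n) ⟨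
      (rk ν k n + rk ν j x) + t
        ≤⟨ +-monoˡ-≤ t (rankF-quadrangle (ν ⟨$⟩ʳ_) k≤j x≤n) ⟩
      (rk ν k x + rk ν j n) + t
        ≤⟨ +-monoˡ-≤ t (+-mono-≤ (σ⊑ν k x k≤n x≤n)
                                 (≤-reflexive (rankF-allʳ (ν ⟨$⟩ʳ_) j j≤n))) ⟩
      (A x + j) + t         ≡⟨ reorder₂ (A x) j t ⟩
      j + (A x + t)         ≡⟨ cong (j +_) (A+[n∸A] x x≤n) ⟩
      j + n                 ∎
    where
    open ≤-Reasoning
    t = n ∸ A x
    reorder₁ : ∀ a b c → a + b + c ≡ c + a + b
    reorder₁ = solve-∀
    reorder₂ : ∀ a b c → a + b + c ≡ b + (a + c)
    reorder₂ = solve-∀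

  M-suffix : ∀ {j} r → j ≤ k → M j r ≡ suffixMax (G j) r
  M-suffix {j} r j≤k with j ≤? k
  ... | yes _ = refl
  ... | no j≰k = ⊥-elim (j≰k j≤k)

  suffixMax-Gₖ : ∀ r → r ≤ n → suffixMax (G k) r ≡ n
  suffixMax-Gₖ r r≤n = trans (sym (+-identityʳ _))
    (suffixMax-+-attained (G k) r≤n bound r≤n ≤-refl (≤-reflexive (sym Gₖₙ+0≡n)))
    where
    bound : ∀ y → r ≤ y → y ≤ n → G k y + 0 ≤ n
    bound y _ y≤n = ≤-trans (≤-reflexive (+-identityʳ _)) (G≤n ≤-refl y≤n)
    Gₖₙ+0≡n : G k n + 0 ≡ n
    Gₖₙ+0≡n = begin
      G k n + 0             ≡⟨ +-identityʳ _ ⟩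
      rk ν k n + (n ∸ A n)  ≡⟨ cong₂ (λ u w → u + (n ∸ w)) (rankF-allʳ (ν ⟨$⟩ʳ_) k k≤n)
                                                            (rankF-allʳ (σ ⟨$⟩ʳ_) k k≤n) ⟩
      k + (n ∸ k)           ≡⟨ m+[n∸m]≡n k≤n ⟩
      n                     ∎
      where open ≡-Reasoning

  maxUpTo-Gₖ : ∀ r → r ≤ n → maxUpTo (G k) r ≡ n
  maxUpTo-Gₖ r r≤n = trans (sym (+-identityʳ _))
    (maxUpTo-+-attained (G k) r bound z≤n (≤-reflexive (sym Gₖ₀+0≡n)))
    where
    bound : ∀ y → y ≤ r → G k y + 0 ≤ n
    bound y y≤r = ≤-trans (≤-reflexive (+-identityʳ _)) (G≤n ≤-refl (≤-trans y≤r r≤n))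
    Gₖ₀+0≡n : G k 0 + 0 ≡ n
    Gₖ₀+0≡n = trans (+-identityʳ _)
      (cong₂ (λ u w → u + (n ∸ w)) (rankF-zeroʳ (ν ⟨$⟩ʳ_) k) (rankF-zeroʳ (σ ⟨$⟩ʳ_) k))

  M-prefix : ∀ {j} r → r ≤ n → k ≤ j → M j r ≡ maxUpTo (G j) r
  M-prefix {j} r r≤n k≤j with j ≤? k
  ... | no _ = refl
  ... | yes j≤k with ≤-antisym j≤k k≤j
  ...   | refl = trans (suffixMax-Gₖ r r≤n) (sym (maxUpTo-Gₖ r r≤n))

  G≤M : ∀ j r → r ≤ n → G j r ≤ M j r
  G≤M j r r≤n with j ≤? k
  ... | yes _ = ≤-suffixMax (G j) ≤-refl r≤n
  ... | no _ = ≤-maxUpTo (G j) {r} ≤-refl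

  G-bump : ∀ j (j<n : j < n) → Bump (G j) (G (suc j)) (toℕ (ν ⟨$⟩ʳ fromℕ< j<n))
  G-bump j j<n x with [<]-cases (toℕ (ν ⟨$⟩ʳ fromℕ< j<n)) x
  ... | inj₁ (νj<x , e) = inj₂ (cong (_+ (n ∸ A x)) (trans (rankF-sucˡ (ν ⟨$⟩ʳ_) j j<n x)
                                  (trans (cong (rk ν j x +_) e) (+-comm _ 1))) , νj<x)
  ... | inj₂ (νj≮x , e) = inj₁ (cong (_+ (n ∸ A x)) (trans (rankF-sucˡ (ν ⟨$⟩ʳ_) j j<n x)
                                  (trans (cong (rk ν j x +_) e) (+-identityʳ _))) , ≮⇒≥ νj≮x)

  suffixMax-jump-persists : ∀ {g g′ v} → Bump g g′ v → ∀ {r} → r < n →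
    Jump (suffixMax g r) (suffixMax g′ r) → Jump (suffixMax g (suc r)) (suffixMax g′ (suc r))
  suffixMax-jump-persists {g} {g′} bump {r} r<n jump = maxFrom-jump-persists bump r (n ∸ suc r)
    (subst (λ d → Jump (maxFrom g r d) (maxFrom g′ r d)) (+-∸-assoc 1 r<n) jump)

  M-step : ∀ j → j < n → ∀ r → r ≤ n → Δ01 (M j r) (M (suc j) r)
  M-step j j<n r r≤n with k ≤? j
  ... | no k≰j =
    subst₂ Δ01 (sym (M-suffix r (<⇒≤ 1+j≤k))) (sym (M-suffix r 1+j≤k))
      (maxFrom-bump (G-bump j j<n) r (n ∸ r))
    where 1+j≤k = ≰⇒> k≰j
  ... | yes k≤j =
    subst₂ Δ01 (sym (M-prefix r r≤n k≤j)) (sym (M-prefix r r≤n (m≤n⇒m≤1+n k≤j)))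
      (maxUpTo-bump (G-bump j j<n) r)

  M-jump-persists : ∀ j → j < n → ∀ r → r < n →
    Jump (M j r) (M (suc j) r) → Jump (M j (suc r)) (M (suc j) (suc r))
  M-jump-persists j j<n r r<n jump with k ≤? j
  ... | no k≰j =
    subst₂ Jump (sym (M-suffix (suc r) j≤k)) (sym (M-suffix (suc r) 1+j≤k))
      (suffixMax-jump-persists (G-bump j j<n) r<n
        (subst₂ Jump (M-suffix r j≤k) (M-suffix r 1+j≤k) jump))
    where
    1+j≤k = ≰⇒> k≰j
    j≤k = <⇒≤ 1+j≤k
  ... | yes k≤j =
    subst₂ Jump (sym (M-prefix (suc r) r<n k≤j)) (sym (M-prefix (suc r) r<n k≤1+j))
      (maxUpTo-jump-persists (G-bump j j<n) r
        (subst₂ Jump (M-prefix r (<⇒≤ r<n) k≤j) (M-prefix r (<⇒≤ r<n) k≤1+j) jump))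
    where k≤1+j = m≤n⇒m≤1+n k≤j

  n≤G+A : ∀ j r → r ≤ n → n ≤ G j r + A r
  n≤G+A j r r≤n = ≤-trans (m≤n+m n (rk ν j r)) (≤-reflexive (sym (G+A≡ j r r≤n)))

  n≤M+A : ∀ j r → r ≤ n → n ≤ M j r + A r
  n≤M+A j r r≤n = ≤-trans (n≤G+A j r r≤n) (+-monoˡ-≤ (A r) (G≤M j r r≤n))

  R-step : ∀ j → j < n → ∀ r → r ≤ n → Δ01 (R j r) (R (suc j) r)
  R-step j j<n r r≤n = +-∸-Δ01 (A r) n (n≤M+A j r r≤n) (M-step j j<n r r≤n)

  R-jump-persists : ∀ j → j < n → ∀ r → r < n →
    Jump (R j r) (R (suc j) r) → Jump (R j (suc r)) (R (suc j) (suc r))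
  R-jump-persists j j<n r r<n jump = +-∸-jump (A (suc r)) n (n≤M+A j (suc r) r<n)
    (M-jump-persists j j<n r r<n (+-∸-jump⁻¹ (A r) n (n≤M+A j r r≤n) (M-step j j<n r r≤n) jump))
    where r≤n = <⇒≤ r<n

  R≡ : ∀ {j r v} → M j r + A r ≡ v + n → R j r ≡ v
  R≡ {j} {r} {v} M+A≡v+n = trans (cong (_∸ n) M+A≡v+n) (m+n∸n≡m v n)

  R-row₀ : ∀ r → r ≤ n → R 0 r ≡ 0
  R-row₀ r r≤n = R≡ {0} {r} (trans (cong (_+ A r) (M-suffix r z≤n))
    (suffixMax-+-attained (G 0) r≤n bound ≤-refl r≤n (n≤G+A 0 r r≤n)))
    where
    bound : ∀ y → r ≤ y → y ≤ n → G 0 y + A r ≤ 0 + n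
    bound y r≤y y≤n = ≤-trans (G+A≤ 0 r≤y y≤n) (≤-reflexive (cong (_+ n) (rankF-zeroˡ (ν ⟨$⟩ʳ_) y)))

  G+A≤⇐slope : ∀ {j y r w} → y ≤ n → rk ν j y + A r ≤ w + A y → G j y + A r ≤ w + n
  G+A≤⇐slope {j} {y} {r} {w} y≤n slope = begin
      rk ν j y + t + A r     ≡⟨ reorder (rk ν j y) t (A r) ⟩
      (rk ν j y + A r) + t   ≤⟨ +-monoˡ-≤ t slope ⟩
      (w + A y) + t          ≡⟨ +-assoc w (A y) t ⟩
      w + (A y + t)          ≡⟨ cong (w +_) (A+[n∸A] y y≤n) ⟩
      w + n                  ∎
    where
    open ≤-Reasoning
    t = n ∸ A y
    reorder : ∀ a b c → a + b + c ≡ a + c + b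
    reorder = solve-∀

  A₀≡0 : A 0 ≡ 0
  A₀≡0 = rankF-zeroʳ (σ ⟨$⟩ʳ_) k

  Aₙ≡k : A n ≡ k
  Aₙ≡k = rankF-allʳ (σ ⟨$⟩ʳ_) k k≤n

  R-col₀ : ∀ j → R j 0 ≡ 0
  R-col₀ j with k ≤? j
  ... | yes k≤j = R≡ {j} {0} (trans (cong (_+ A 0) (M-prefix 0 z≤n k≤j))
      (trans (G+A≡ j 0 z≤n) (cong (_+ n) (rankF-zeroʳ (ν ⟨$⟩ʳ_) j))))
  ... | no k≰j = R≡ {j} {0} (trans (cong (_+ A 0) (M-suffix 0 j≤k))
      (suffixMax-+-attained (G j) z≤n bound z≤n z≤n (n≤G+A j 0 z≤n)))
    where
    j≤k = <⇒≤ (≰⇒> k≰j)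
    bound : ∀ y → 0 ≤ y → y ≤ n → G j y + A 0 ≤ 0 + n
    bound y _ y≤n = ≤-trans (≤-reflexive (trans (cong (G j y +_) A₀≡0) (+-identityʳ _))) (G≤n j≤k y≤n)

  Gₙ+Aₙ≡j+n : ∀ {j} → j ≤ n → G j n + A n ≡ j + n
  Gₙ+Aₙ≡j+n {j} j≤n = trans (G+A≡ j n ≤-refl) (cong (_+ n) (rankF-allʳ (ν ⟨$⟩ʳ_) j j≤n))

  R-colₙ : ∀ j → j ≤ n → R j n ≡ j
  R-colₙ j j≤n with k ≤? j
  ... | yes k≤j = R≡ {j} {n} (trans (cong (_+ A n) (M-prefix n ≤-refl k≤j))
      (maxUpTo-+-attained (G j) n bound ≤-refl (≤-reflexive (sym (Gₙ+Aₙ≡j+n j≤n)))))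
    where
    bound : ∀ y → y ≤ n → G j y + A n ≤ j + n
    bound y y≤n = subst (λ a → G j y + a ≤ j + n) (sym Aₙ≡k) (G+k≤j+n k≤j j≤n y≤n)
  ... | no k≰j = R≡ {j} {n} (trans (cong (_+ A n) (M-suffix n (<⇒≤ (≰⇒> k≰j))))
      (trans (cong (λ d → maxFrom (G j) n d + A n) (n∸n≡0 n)) (Gₙ+Aₙ≡j+n j≤n)))

  R-rowₙ : ∀ r → r ≤ n → R n r ≡ r
  R-rowₙ r r≤n = R≡ {n} {r} (trans (cong (_+ A r) (M-prefix r r≤n k≤n))
      (maxUpTo-+-attained (G n) r bound ≤-refl (≤-reflexive (sym Gₙᵣ+Aᵣ≡r+n))))
    where
    Gₙᵣ+Aᵣ≡r+n : G n r + A r ≡ r + n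
    Gₙᵣ+Aᵣ≡r+n = trans (G+A≡ n r r≤n) (cong (_+ n) (rk-allˡ ν r r≤n))
    bound : ∀ y → y ≤ r → G n y + A r ≤ r + n
    bound y y≤r = G+A≤⇐slope {n} {y} {r} {r} y≤n (begin
        rk ν n y + A r   ≡⟨ cong (_+ A r) (rk-allˡ ν y y≤n) ⟩
        y + A r          ≡⟨ +-comm y (A r) ⟩
        A r + y          ≤⟨ A-slope y≤r r≤n ⟩
        A y + r          ≡⟨ +-comm (A y) r ⟩
        r + A y          ∎)
      where
      open ≤-Reasoning
      y≤n = ≤-trans y≤r r≤n

  R-k : ∀ r → r ≤ n → R k r ≡ A r
  R-k r r≤n = begin
    (M k r + A r) ∸ n   ≡⟨ cong (λ m → (m + A r) ∸ n) (trans (M-suffix r ≤-refl) (suffixMax-Gₖ r r≤n)) ⟩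
    (n + A r) ∸ n       ≡⟨ m+n∸m≡n n (A r) ⟩
    A r                 ∎
    where open ≡-Reasoning

  rkν≤R : ∀ j r → r ≤ n → rk ν j r ≤ R j r
  rkν≤R j r r≤n = m+n≤o⇒m≤o∸n (rk ν j r) (begin
      rk ν j r + n   ≡⟨ G+A≡ j r r≤n ⟨
      G j r + A r    ≤⟨ +-monoˡ-≤ (A r) (G≤M j r r≤n) ⟩
      M j r + A r    ∎)
    where open ≤-Reasoning

  R≤rk : ∀ μ → SameRow k σ μ → μ ⊑ ν → ∀ j r → j ≤ n → r ≤ n → R j r ≤ rk μ j r
  R≤rk μ same μ⊑ν j r j≤n r≤n =
    m≤n+o⇒m∸n≤o (M j r + A r) n (subst (M j r + A r ≤_) (+-comm (rk μ j r) n) M+A≤)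
    where
    bound : ∀ {y} → y ≤ n → rk μ j y + A r ≤ rk μ j r + A y → G j y + A r ≤ rk μ j r + n
    bound {y} y≤n slope = G+A≤⇐slope {j} {y} {r} {rk μ j r} y≤n
      (≤-trans (+-monoˡ-≤ (A r) (μ⊑ν j y j≤n y≤n)) slope)
    slope : ∀ {y} → y ≤ n →
      rk μ j y + rk μ k r ≤ rk μ j r + rk μ k y → rk μ j y + A r ≤ rk μ j r + A y
    slope y≤n = subst₂ (λ u w → _ + u ≤ _ + w) (same r r≤n) (same _ y≤n)
    M+A≤ : M j r + A r ≤ rk μ j r + n
    M+A≤ with k ≤? j
    ... | yes k≤j = subst (_≤ rk μ j r + n) (cong (_+ A r) (sym (M-prefix r r≤n k≤j)))
        (maxUpTo-+-lub (G j) r (λ y y≤r → bound (≤-trans y≤r r≤n) (slope (≤-trans y≤r r≤n)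
          (subst₂ _≤_ (+-comm (rk μ k r) _) (+-comm (rk μ k y) _) (rankF-quadrangle (μ ⟨$⟩ʳ_) k≤j y≤r)))))
    ... | no k≰j = subst (_≤ rk μ j r + n) (cong (_+ A r) (sym (M-suffix r (<⇒≤ (≰⇒> k≰j)))))
        (suffixMax-+-lub (G j) r≤n (λ y r≤y y≤n → bound y≤n (slope y≤n
          (rankF-quadrangle (μ ⟨$⟩ʳ_) (<⇒≤ (≰⇒> k≰j)) r≤y))))

  open Realization n R R-row₀ (λ j _ → R-col₀ j) R-colₙ R-rowₙ R-step R-jump-persists
    using (realization)

  b : Permutation′ n
  b = proj₁ realization

  rk-b : ∀ j r → j ≤ n → r ≤ n → rk b j r ≡ R j r
  rk-b = proj₂ realization

  b-SameRow : SameRow k σ b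
  b-SameRow r r≤n = trans (rk-b k r k≤n r≤n) (R-k r r≤n)

  b≤ν : b ≤B ν
  b≤ν = ⊑⇒≤B {σ = b} {ν} (λ j r j≤n r≤n → subst (rk ν j r ≤_) (sym (rk-b j r j≤n r≤n)) (rkν≤R j r r≤n))

  ≤B-b : ∀ {μ} → SameRow k σ μ → μ ≤B ν → μ ≤B b
  ≤B-b {μ} same μ≤ν = ⊑⇒≤B {σ = μ} {b} (λ j r j≤n r≤n →
    subst (_≤ rk μ j r) (sym (rk-b j r j≤n r≤n)) (R≤rk μ same (≤B⇒⊑ {σ = μ} {ν} μ≤ν) j r j≤n r≤n))

  between⇒SameRow : ∀ {μ} → σ ≤B μ → μ ≤B b → SameRow k σ μ
  between⇒SameRow {μ} σ≤μ μ≤b r r≤n = ≤-antisym (≤B⇒⊑ {σ = σ} {μ} σ≤μ k r k≤n r≤n)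
    (subst (_≤ rk μ k r) (b-SameRow r r≤n) (≤B⇒⊑ {σ = μ} {b} μ≤b k r k≤n r≤n))

  coset-interval⇔ : ∀ μ → InCosetInterval k σ ν μ ⇔ (σ ≤B μ × μ ≤B b)
  coset-interval⇔ μ = mk⇔
    (λ (coset , σ≤μ , μ≤ν) → σ≤μ , ≤B-b {μ} (InCoset⇒SameRow k σ μ coset) μ≤ν)
    (λ (σ≤μ , μ≤b) → SameRow⇒InCoset k σ μ (between⇒SameRow {μ} σ≤μ μ≤b)
                   , σ≤μ , ≤B-trans {σ = μ} {b} {ν} μ≤b b≤ν)

lemma2p3p12 : ∀ (n : ℕ) (σ ν : Permutation′ n) (k : ℕ) →
    σ <B ν → 1 ≤ k → k < n →
    ∃[ a ] ∃[ b ] (InCosetInterval k σ ν a × InCosetInterval k σ ν b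
    × (∀ μ → InCosetInterval k σ ν μ ⇔ (a ≤B μ × μ ≤B b)))
lemma2p3p12 n σ ν k (σ≤ν , _) _ k<n =
  σ , b , σ∈ , Equivalence.from (coset-interval⇔ b) (σ≤b , ≤B-refl {σ = b}) , coset-interval⇔
  where
  open MaximalElement σ ν k (<⇒≤ k<n) (≤B⇒⊑ {σ = σ} {ν} σ≤ν)
  σ∈ : InCosetInterval k σ ν σ
  σ∈ = (λ _ → id , id) , ≤B-refl {σ = σ} , σ≤ν
  σ≤b : σ ≤B b
  σ≤b = ≤B-b {σ} (λ _ _ → refl) σ≤ν
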